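{- Let $n\ge 1$ and let $\mathcal F\subset\mathcal G\subset 2^{[n]}$, where $\mathcal G$ is a down-set and $\mathcal F$ is intersecting. If $\tau(\mathcal F)\le 2$, then $|\mathcal F|\le\Delta(\mathcal G):=\max_{x\in[n]}|\{G\in\mathcal G: x\in G\}|$.
   Context: A family $\mathcal G\subset 2^{[n]}$ is a down-set if $B\in\mathcal G$ and $A\subset B$ imply $A\in\mathcal G$. A family $\mathcal F$ is intersecting if $A\cap B\ne\emptyset$ for all $A,B\in\mathcal F$. For a family $\mathcal F$ of non-empty sets, the covering number $\tau(\mathcal F)$ is the minimum integer $t$ such that there is a $t$-element set $T$ with $T\cap F\ne\emptyset$ for all $F\in\mathcal F$. -}

module Defs where

open import Data.Nat using (ℕ; _⊔_)
open import Data.Fin using (Fin)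
open import Data.Fin.Subset using (Subset; _∈_; _⊆_; _∩_; Nonempty; ∣_∣)
open import Data.Fin.Subset.Properties using (_∈?_)
open import Data.List using (List; length; filter; map; foldr; allFin)
open import Data.List.Relation.Unary.Unique.Propositional using (Unique)
import Data.List.Membership.Propositional as L
open import Data.Product using (∃; _×_)
open import Data.Nat using (_≤_)

-- A family of subsets of [n] = Fin n, represented as a duplicate-free list
-- of subsets (so |𝓕| = length of the list).
record Family (n : ℕ) : Set where
  constructor family
  field
    members : List (Subset n)
    unique  : Unique members
open Family public

_∈F_ : ∀ {n} → Subset n → Family n → Set
A ∈F 𝓕 = A L.∈ members 𝓕

∣_∣F : ∀ {n} → Family n → ℕ
∣ 𝓕 ∣F = length (members 𝓕)

_⊆F_ : ∀ {n} → Family n → Family n → Set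
𝓕 ⊆F 𝓖 = ∀ {A} → A ∈F 𝓕 → A ∈F 𝓖

DownSet : ∀ {n} → Family n → Set
DownSet 𝓖 = ∀ {A B} → B ∈F 𝓖 → A ⊆ B → A ∈F 𝓖

Intersecting : ∀ {n} → Family n → Set
Intersecting 𝓕 = ∀ {A B} → A ∈F 𝓕 → B ∈F 𝓕 → Nonempty (A ∩ B)

Covers : ∀ {n} → Subset n → Family n → Set
Covers T 𝓕 = ∀ {F} → F ∈F 𝓕 → Nonempty (T ∩ F)

-- τ(𝓕) ≤ t : there is a set T with |T| ≤ t meeting every member of 𝓕
-- (since τ is the minimum such size, τ(𝓕) ≤ t iff such a T exists)
τ≤ : ∀ {n} → Family n → ℕ → Set
τ≤ 𝓕 t = ∃ λ T → ∣ T ∣ ≤ t × Covers T 𝓕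

degree : ∀ {n} → Family n → Fin n → ℕ
degree 𝓖 x = length (filter (x ∈?_) (members 𝓖))

Δ : ∀ {n} → Family n → ℕ
Δ {n} 𝓖 = foldr _⊔_ 0 (map (degree 𝓖) (allFin n))

-- Let {x, y} cover 𝓕. For either point z, |𝓕| = |𝓕 ∋ z| + |𝓕 ∌ z| and, as 𝓕 ⊆ 𝓖,
-- deg_𝓖 z ≥ |𝓕 ∋ z| + |(𝓖 ∖ 𝓕) ∋ z|; so it suffices that |𝓕 ∌ z| ≤ |(𝓖 ∖ 𝓕) ∋ z| for
-- z = x or z = y, which follows from |𝓕 ∌ y| · |𝓕 ∌ x| ≤ |(𝓖 ∖ 𝓕) ∋ y| · |(𝓖 ∖ 𝓕) ∋ x|.
-- If S ∌ y and T ∌ x are in 𝓕, then T ∖ S ∋ y and S ∖ T ∋ x lie in 𝓖 (a down-set) but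
-- not in 𝓕 (they miss S, resp. T, and 𝓕 is intersecting). The product inequality is thus
-- the Ahlswede–Daykin four functions theorem, in its form for α S · β T ≤ γ (T ∖ S) · δ (S ∖ T).

module Submission where

open import Defs
open import Data.Bool using (Bool; true; false; not; _∧_; _∨_; if_then_else_)
import Data.Bool.Properties as Bool
open import Data.Bool.Properties using (∧-identityʳ)
open import Data.Empty using (⊥-elim)
open import Data.Fin using (Fin; zero; suc)
open import Data.Fin.Subset
  using (Subset; inside; outside; _∪_; _∩_; _─_; ∁; _∉_; ∣_∣)
  renaming (_∈_ to _∈ˢ_)
open import Data.Fin.Subset.Properties
  using (_∈?_; x∈p∩q⁻; x∈p∧x∉q⇒x∈p─q; p─q⊆p; ∩-comm)
open import Data.List using (List; []; _∷_; length; filter; foldr)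
open import Data.List.Properties using (filter-all)
import Data.List.Relation.Unary.All as All
open import Data.List.Relation.Unary.Any using (any?)
import Data.List.Relation.Unary.Any as Any
open import Data.List.Relation.Unary.All.Properties using (All¬⇒¬Any)
open import Data.List.Relation.Unary.AllPairs using ([]; _∷_)
open import Data.List.Relation.Unary.Unique.Propositional using (Unique)
import Data.List.Membership.Propositional as List
open import Data.List.Membership.Propositional.Properties using (∈-allFin; ∈-map⁺)
open import Data.Nat
open import Data.Nat.Properties
open import Algebra.Properties.CommutativeSemigroup +-commutativeSemigroup using (interchange)
open import Data.Nat.Solver using (module +-*-Solver)
open import Data.Product using (∃; ∃₂; _,_; _×_; proj₁; proj₂)
open import Data.Sum using (_⊎_; inj₁; inj₂)
import Data.Sum as Sum
open import Data.Unit using (tt)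
open import Data.Vec using ([]; _∷_; here; there)
open import Data.Vec.Properties using (≡-dec)
open import Relation.Nullary using (Dec; yes; no; does; ¬_; _×-dec_; ¬?)
open import Relation.Nullary.Decidable using (dec-true; dec-false)
open import Level using (0ℓ)
open import Relation.Unary using (Pred; Decidable)
open import Relation.Binary.PropositionalEquality
open import Relation.Binary.Definitions using (DecidableEquality)

open +-*-Solver using (solve; _:+_; _:*_; _:=_)

-- (u ∸ p) * (u ∸ q) ≥ 0, with u written as p + r so that no subtraction occurs.
u*[p+q]≤u*u+p*q : ∀ {p q u} → p ≤ u → q ≤ u → u * (p + q) ≤ u * u + p * q
u*[p+q]≤u*u+p*q {p} {q} p≤u q≤u with r , refl ← m≤n⇒∃[o]m+o≡n p≤u = begin
  (p + r) * (p + q)                 ≡⟨ expand ⟩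
  (p + r) * p + p * q + r * q       ≤⟨ +-monoʳ-≤ ((p + r) * p + p * q) (*-monoʳ-≤ r q≤u) ⟩
  (p + r) * p + p * q + r * (p + r) ≡⟨ collect ⟩
  (p + r) * (p + r) + p * q         ∎
  where
  open ≤-Reasoning
  expand : (p + r) * (p + q) ≡ (p + r) * p + p * q + r * q
  expand = solve 3 (λ p q r → (p :+ r) :* (p :+ q) := (p :+ r) :* p :+ p :* q :+ r :* q) refl p q r
  collect : (p + r) * p + p * q + r * (p + r) ≡ (p + r) * (p + r) + p * q
  collect = solve 3 (λ p q r → (p :+ r) :* p :+ p :* q :+ r :* (p :+ r) := (p :+ r) :* (p :+ r) :+ p :* q) refl p q r

p+q≤u+r : ∀ {p q u r} → p ≤ u → q ≤ u → p * q ≤ u * r → p + q ≤ u + r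
p+q≤u+r {u = zero} z≤n z≤n _ = z≤n
p+q≤u+r {p} {q} {u@(suc _)} {r} p≤u q≤u pq≤ur = *-cancelˡ-≤ u (begin
  u * (p + q)   ≤⟨ u*[p+q]≤u*u+p*q p≤u q≤u ⟩
  u * u + p * q ≤⟨ +-monoʳ-≤ (u * u) pq≤ur ⟩
  u * u + u * r ≡⟨ *-distribˡ-+ u u r ⟨
  u * (u + r)   ∎)
  where open ≤-Reasoning

m*n≤o*p⇒m≤o⊎n≤p : ∀ {m n o p} → m * n ≤ o * p → m ≤ o ⊎ n ≤ p
m*n≤o*p⇒m≤o⊎n≤p {m} {n} {o} {p} mn≤op with m ≤? o | n ≤? p
... | yes m≤o | _       = inj₁ m≤o
... | no  _   | yes n≤p = inj₂ n≤p
... | no  m≰o | no  n≰p = ⊥-elim (<⇒≱ (*-mono-< (≰⇒> m≰o) (≰⇒> n≰p)) mn≤op)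

four-functions-base : (α β γ δ : Bool → ℕ) →
  (∀ i j → α i * β j ≤ γ (i ∨ j) * δ (i ∧ j)) →
  (α false + α true) * (β false + β true) ≤ (γ false + γ true) * (δ false + δ true)
four-functions-base α β γ δ h = begin
  (a₀ + a₁) * (b₀ + b₁)                   ≡⟨ expand a₀ a₁ b₀ b₁ ⟩
  a₀ * b₀ + a₁ * b₁ + (a₀ * b₁ + a₁ * b₀)
    ≤⟨ +-mono-≤ (+-mono-≤ (h false false) (h true true)) (p+q≤u+r (h false true) (h true false) cross) ⟩
  c₀ * d₀ + c₁ * d₁ + (c₁ * d₀ + c₀ * d₁) ≡⟨ collect ⟩
  (c₀ + c₁) * (d₀ + d₁)                   ∎
  where
  a₀ a₁ b₀ b₁ c₀ c₁ d₀ d₁ : ℕ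
  a₀ = α false
  a₁ = α true
  b₀ = β false
  b₁ = β true
  c₀ = γ false
  c₁ = γ true
  d₀ = δ false
  d₁ = δ true
  open ≤-Reasoning
  expand : ∀ a₀ a₁ b₀ b₁ → (a₀ + a₁) * (b₀ + b₁) ≡ a₀ * b₀ + a₁ * b₁ + (a₀ * b₁ + a₁ * b₀)
  expand = solve 4 (λ a₀ a₁ b₀ b₁ →
    (a₀ :+ a₁) :* (b₀ :+ b₁) := a₀ :* b₀ :+ a₁ :* b₁ :+ (a₀ :* b₁ :+ a₁ :* b₀)) refl
  collect : c₀ * d₀ + c₁ * d₁ + (c₁ * d₀ + c₀ * d₁) ≡ (c₀ + c₁) * (d₀ + d₁)
  collect = sym (trans (expand c₀ c₁ d₀ d₁) (cong (c₀ * d₀ + c₁ * d₁ +_) (+-comm (c₀ * d₁) (c₁ * d₀))))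
  regroup : ∀ a b c d → (a * b) * (c * d) ≡ (a * d) * (c * b)
  regroup = solve 4 (λ a b c d → (a :* b) :* (c :* d) := (a :* d) :* (c :* b)) refl
  cross : (a₀ * b₁) * (a₁ * b₀) ≤ (c₁ * d₀) * (c₀ * d₁)
  cross = begin
    (a₀ * b₁) * (a₁ * b₀) ≡⟨ regroup a₀ b₁ a₁ b₀ ⟩
    (a₀ * b₀) * (a₁ * b₁) ≤⟨ *-mono-≤ (h false false) (h true true) ⟩
    (c₀ * d₀) * (c₁ * d₁) ≡⟨ trans (regroup c₀ d₀ c₁ d₁) (*-comm (c₀ * d₁) (c₁ * d₀)) ⟩
    (c₁ * d₀) * (c₀ * d₁) ∎

marginal : ∀ {n} → (Subset (suc n) → ℕ) → Subset n → ℕ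
marginal f s = f (outside ∷ s) + f (inside ∷ s)

sumSubsets : ∀ n → (Subset n → ℕ) → ℕ
sumSubsets zero    f = f []
sumSubsets (suc n) f = sumSubsets n (marginal f)

sumSubsets-mono : ∀ n {f g : Subset n → ℕ} → (∀ s → f s ≤ g s) → sumSubsets n f ≤ sumSubsets n g
sumSubsets-mono zero    f≤g = f≤g []
sumSubsets-mono (suc n) f≤g = sumSubsets-mono n (λ s → +-mono-≤ (f≤g (outside ∷ s)) (f≤g (inside ∷ s)))

sumSubsets-cong : ∀ n {f g : Subset n → ℕ} → (∀ s → f s ≡ g s) → sumSubsets n f ≡ sumSubsets n g
sumSubsets-cong zero    f≗g = f≗g []
sumSubsets-cong (suc n) f≗g = sumSubsets-cong n (λ s → cong₂ _+_ (f≗g (outside ∷ s)) (f≗g (inside ∷ s)))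

sumSubsets-+ : ∀ n (f g : Subset n → ℕ) →
  sumSubsets n (λ s → f s + g s) ≡ sumSubsets n f + sumSubsets n g
sumSubsets-+ zero    f g = refl
sumSubsets-+ (suc n) f g = trans
  (sumSubsets-cong n (λ s → interchange (f (outside ∷ s)) (g (outside ∷ s)) (f (inside ∷ s)) (g (inside ∷ s))))
  (sumSubsets-+ n (marginal f) (marginal g))

sumSubsets-∁ : ∀ n (f : Subset n → ℕ) → sumSubsets n (λ s → f (∁ s)) ≡ sumSubsets n f
sumSubsets-∁ zero    f = refl
sumSubsets-∁ (suc n) f = trans
  (sumSubsets-∁ n (λ s → f (inside ∷ s) + f (outside ∷ s)))
  (sumSubsets-cong n (λ s → +-comm (f (inside ∷ s)) (f (outside ∷ s))))

_≟ˢ_ : ∀ {n} → DecidableEquality (Subset n)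
_≟ˢ_ = ≡-dec Bool._≟_

sumSubsets-point : ∀ n (a : Subset n) (f : Subset n → ℕ) →
  sumSubsets n (λ s → if does (s ≟ˢ a) then f s else 0) ≡ f a
sumSubsets-point zero    []            f = refl
sumSubsets-point (suc n) (inside ∷ a)  f = sumSubsets-point n a (λ s → f (inside ∷ s))
sumSubsets-point (suc n) (outside ∷ a) f = trans
  (sumSubsets-cong n (λ s → +-identityʳ _))
  (sumSubsets-point n a (λ s → f (outside ∷ s)))

four-functions : ∀ n (α β γ δ : Subset n → ℕ) →
  (∀ s t → α s * β t ≤ γ (s ∪ t) * δ (s ∩ t)) →
  sumSubsets n α * sumSubsets n β ≤ sumSubsets n γ * sumSubsets n δ
four-functions zero    α β γ δ h = h [] []
four-functions (suc n) α β γ δ h =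
  four-functions n (marginal α) (marginal β) (marginal γ) (marginal δ) λ s t →
    four-functions-base (λ i → α (i ∷ s)) (λ j → β (j ∷ t)) (λ i → γ (i ∷ s ∪ t)) (λ i → δ (i ∷ s ∩ t))
                        (λ i j → h (i ∷ s) (j ∷ t))

∁q─p≡∁[p∪q] : ∀ {n} (p q : Subset n) → ∁ q ─ p ≡ ∁ (p ∪ q)
∁q─p≡∁[p∪q] []            []      = refl
∁q─p≡∁[p∪q] (inside ∷ p)  (_ ∷ q) = cong (outside ∷_) (∁q─p≡∁[p∪q] p q)
∁q─p≡∁[p∪q] (outside ∷ p) (x ∷ q) = cong (not x ∷_) (∁q─p≡∁[p∪q] p q)

p─∁q≡q∩p : ∀ {n} (p q : Subset n) → p ─ ∁ q ≡ q ∩ p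
p─∁q≡q∩p []      []            = refl
p─∁q≡q∩p (_ ∷ p) (inside ∷ q)  = cong (_ ∷_) (p─∁q≡q∩p p q)
p─∁q≡q∩p (_ ∷ p) (outside ∷ q) = cong (outside ∷_) (p─∁q≡q∩p p q)

-- The four functions theorem applied to β ∘ ∁ and γ ∘ ∁.
four-functions-─ : ∀ n (α β γ δ : Subset n → ℕ) →
  (∀ s t → α s * β t ≤ γ (t ─ s) * δ (s ─ t)) →
  sumSubsets n α * sumSubsets n β ≤ sumSubsets n γ * sumSubsets n δ
four-functions-─ n α β γ δ h = subst₂ _≤_
  (cong (sumSubsets n α *_) (sumSubsets-∁ n β))
  (cong (_* sumSubsets n δ) (sumSubsets-∁ n γ))
  (four-functions n α (λ t → β (∁ t)) (λ u → γ (∁ u)) δ λ s t →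
    subst₂ (λ u v → α s * β (∁ t) ≤ γ u * δ v)
      (∁q─p≡∁[p∪q] s t) (trans (p─∁q≡q∩p s t) (∩-comm t s)) (h s (∁ t)))

𝟙 : Bool → ℕ
𝟙 true  = 1
𝟙 false = 0

𝟙-split : ∀ {A B : Set} (a? : Dec A) (b? : Dec B) →
  𝟙 (does a?) ≡ 𝟙 (does (a? ×-dec b?)) + 𝟙 (does (a? ×-dec ¬? b?))
𝟙-split (yes _) (yes _) = refl
𝟙-split (yes _) (no  _) = refl
𝟙-split (no  _) _       = refl

𝟙-mono : ∀ {A B : Set} (a? : Dec A) (b? : Dec B) → (A → B) → 𝟙 (does a?) ≤ 𝟙 (does b?)
𝟙-mono (no  _) _       _   = z≤n
𝟙-mono (yes _) (yes _) _   = ≤-refl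
𝟙-mono (yes a) (no ¬b) A⇒B = ⊥-elim (¬b (A⇒B a))

𝟙-*-mono : ∀ {A B C D : Set} (a? : Dec A) (b? : Dec B) (c? : Dec C) (d? : Dec D) →
  (A → B → C × D) → 𝟙 (does a?) * 𝟙 (does b?) ≤ 𝟙 (does c?) * 𝟙 (does d?)
𝟙-*-mono (no  _) _       _  _  _ = z≤n
𝟙-*-mono (yes _) (no  _) _  _  _ = z≤n
𝟙-*-mono (yes a) (yes b) c? d? h
  rewrite dec-true c? (proj₁ (h a b)) | dec-true d? (proj₂ (h a b)) = ≤-refl

count : ∀ {n} {P : Pred (Subset n) 0ℓ} → Decidable P → ℕ
count {n} P? = sumSubsets n (λ s → 𝟙 (does (P? s)))

module _ {n} {P Q : Pred (Subset n) 0ℓ} (P? : Decidable P) where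

  count-split : (Q? : Decidable Q) →
    count P? ≡ count (λ s → P? s ×-dec Q? s) + count (λ s → P? s ×-dec ¬? (Q? s))
  count-split Q? = trans (sumSubsets-cong n (λ s → 𝟙-split (P? s) (Q? s))) (sumSubsets-+ n _ _)

  count-mono : (Q? : Decidable Q) → (∀ {s} → P s → Q s) → count P? ≤ count Q?
  count-mono Q? P⇒Q = sumSubsets-mono n (λ s → 𝟙-mono (P? s) (Q? s) P⇒Q)

_∈ᴸ?_ : ∀ {n} (s : Subset n) (L : List (Subset n)) → Dec (s List.∈ L)
s ∈ᴸ? L = any? (s ≟ˢ_) L

sumSubsets-zero : ∀ n → sumSubsets n (λ _ → 0) ≡ 0
sumSubsets-zero zero    = refl
sumSubsets-zero (suc n) = sumSubsets-zero n

length-filter≡count : ∀ {n} {P : Pred (Subset n) 0ℓ} (P? : Decidable P) {L} → Unique L →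
  length (filter P? L) ≡ count (λ s → s ∈ᴸ? L ×-dec P? s)
length-filter≡count {n} P? {[]}    []             = sym (sumSubsets-zero n)
length-filter≡count {n} P? {a ∷ L} (a∉L ∷ unique) = begin
  length (filter P? (a ∷ L))                                   ≡⟨ length-filter-∷ ⟩
  𝟙 (does (P? a)) + length (filter P? L)
    ≡⟨ cong₂ _+_ (sym (sumSubsets-point n a _)) (length-filter≡count P? {L} unique) ⟩
  sumSubsets n at-a + count (λ s → s ∈ᴸ? L ×-dec P? s)         ≡⟨ sumSubsets-+ n at-a _ ⟨
  sumSubsets n (λ s → at-a s + 𝟙 (does (s ∈ᴸ? L ×-dec P? s)))  ≡⟨ sumSubsets-cong n split ⟩
  count (λ s → s ∈ᴸ? (a ∷ L) ×-dec P? s)                       ∎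
  where
  open ≡-Reasoning
  at-a : Subset n → ℕ
  at-a s = if does (s ≟ˢ a) then 𝟙 (does (P? s)) else 0
  length-filter-∷ : length (filter P? (a ∷ L)) ≡ 𝟙 (does (P? a)) + length (filter P? L)
  length-filter-∷ with does (P? a)
  ... | true  = refl
  ... | false = refl
  split : ∀ s → at-a s + 𝟙 (does (s ∈ᴸ? L ×-dec P? s)) ≡ 𝟙 (does (s ∈ᴸ? (a ∷ L) ×-dec P? s))
  split s with s ≟ˢ a
  ... | no  _    = refl
  ... | yes refl rewrite dec-false (a ∈ᴸ? L) (All¬⇒¬Any a∉L) = +-identityʳ _

length≡count : ∀ {n} {L : List (Subset n)} → Unique L → length L ≡ count (_∈ᴸ? L)
length≡count {n} {L} unique = begin
  length L                                        ≡⟨ cong length (filter-all (λ _ → yes tt) (All.universal _ L)) ⟨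
  length (filter (λ _ → yes tt) L)                ≡⟨ length-filter≡count (λ _ → yes tt) unique ⟩
  count (λ s → s ∈ᴸ? L ×-dec yes tt)              ≡⟨ sumSubsets-cong n (λ s → cong 𝟙 (∧-identityʳ _)) ⟩
  count (_∈ᴸ? L)                                  ∎
  where open ≡-Reasoning

x∈p─q⇒x∉q : ∀ {n} {x : Fin n} (p q : Subset n) → x ∈ˢ p ─ q → x ∉ q
x∈p─q⇒x∉q (_ ∷ p) (outside ∷ q) here        ()
x∈p─q⇒x∉q (_ ∷ p) (_ ∷ q)       (there x∈) (there x∈q) = x∈p─q⇒x∉q p q x∈ x∈q

module _ {n} (𝓕 𝓖 : Family n) (𝓕⊆𝓖 : 𝓕 ⊆F 𝓖) where

  𝓕∋? : (z : Fin n) → Decidable (λ s → s ∈F 𝓕 × z ∈ˢ s)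
  𝓕∋? z s = s ∈ᴸ? members 𝓕 ×-dec z ∈? s

  𝓕∌? : (z : Fin n) → Decidable (λ s → s ∈F 𝓕 × z ∉ s)
  𝓕∌? z s = s ∈ᴸ? members 𝓕 ×-dec ¬? (z ∈? s)

  𝓖∖𝓕∋? : (z : Fin n) → Decidable (λ s → (s ∈F 𝓖 × z ∈ˢ s) × ¬ s ∈F 𝓕)
  𝓖∖𝓕∋? z s = (s ∈ᴸ? members 𝓖 ×-dec z ∈? s) ×-dec ¬? (s ∈ᴸ? members 𝓕)

  ∣𝓕∣≡count∋+count∌ : ∀ z → ∣ 𝓕 ∣F ≡ count (𝓕∋? z) + count (𝓕∌? z)
  ∣𝓕∣≡count∋+count∌ z = trans (length≡count (unique 𝓕)) (count-split (_∈ᴸ? members 𝓕) (z ∈?_))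

  count∋+count𝓖∖𝓕∋≤degree : ∀ z → count (𝓕∋? z) + count (𝓖∖𝓕∋? z) ≤ degree 𝓖 z
  count∋+count𝓖∖𝓕∋≤degree z = begin
    count (𝓕∋? z) + count (𝓖∖𝓕∋? z)
      ≤⟨ +-monoˡ-≤ _ (count-mono (𝓕∋? z) (λ s → 𝓖∋? s ×-dec s ∈ᴸ? members 𝓕) 𝓕∋⇒𝓖∋) ⟩
    count (λ s → 𝓖∋? s ×-dec s ∈ᴸ? members 𝓕) + count (𝓖∖𝓕∋? z)
      ≡⟨ count-split 𝓖∋? (_∈ᴸ? members 𝓕) ⟨
    count 𝓖∋?                           ≡⟨ length-filter≡count (z ∈?_) (unique 𝓖) ⟨
    degree 𝓖 z                          ∎
    where
    open ≤-Reasoning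
    𝓖∋? : Decidable (λ s → s ∈F 𝓖 × z ∈ˢ s)
    𝓖∋? s = s ∈ᴸ? members 𝓖 ×-dec z ∈? s
    𝓕∋⇒𝓖∋ : ∀ {s} → s ∈F 𝓕 × z ∈ˢ s → (s ∈F 𝓖 × z ∈ˢ s) × s ∈F 𝓕
    𝓕∋⇒𝓖∋ (s∈𝓕 , z∈s) = (𝓕⊆𝓖 s∈𝓕 , z∈s) , s∈𝓕

  ∣𝓕∣≤degree : ∀ z → count (𝓕∌? z) ≤ count (𝓖∖𝓕∋? z) → ∣ 𝓕 ∣F ≤ degree 𝓖 z
  ∣𝓕∣≤degree z ∌≤𝓖∖𝓕∋ = begin
    ∣ 𝓕 ∣F                            ≡⟨ ∣𝓕∣≡count∋+count∌ z ⟩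
    count (𝓕∋? z) + count (𝓕∌? z)    ≤⟨ +-monoʳ-≤ (count (𝓕∋? z)) ∌≤𝓖∖𝓕∋ ⟩
    count (𝓕∋? z) + count (𝓖∖𝓕∋? z)  ≤⟨ count∋+count𝓖∖𝓕∋≤degree z ⟩
    degree 𝓖 z                        ∎
    where open ≤-Reasoning

  module _ (down : DownSet 𝓖) (intersecting : Intersecting 𝓕) where

    ─-∈𝓖∖𝓕 : ∀ {S T z} → S ∈F 𝓕 → T ∈F 𝓕 → z ∈ˢ S → z ∉ T →
      ((S ─ T) ∈F 𝓖 × z ∈ˢ S ─ T) × ¬ (S ─ T) ∈F 𝓕
    ─-∈𝓖∖𝓕 {S} {T} S∈𝓕 T∈𝓕 z∈S z∉T =
      (down (𝓕⊆𝓖 S∈𝓕) (p─q⊆p S T) , x∈p∧x∉q⇒x∈p─q z∈S z∉T) , S─T∉𝓕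
      where
      S─T∉𝓕 : ¬ (S ─ T) ∈F 𝓕
      S─T∉𝓕 S─T∈𝓕 with w , w∈ ← intersecting S─T∈𝓕 T∈𝓕 with w∈S─T , w∈T ← x∈p∩q⁻ (S ─ T) T w∈ =
        x∈p─q⇒x∉q S T w∈S─T w∈T

    count∌*count∌≤count𝓖∖𝓕∋*count𝓖∖𝓕∋ : ∀ x y → (∀ {F} → F ∈F 𝓕 → x ∈ˢ F ⊎ y ∈ˢ F) →
      count (𝓕∌? y) * count (𝓕∌? x) ≤ count (𝓖∖𝓕∋? y) * count (𝓖∖𝓕∋? x)
    count∌*count∌≤count𝓖∖𝓕∋*count𝓖∖𝓕∋ x y covers = four-functions-─ n _ _ _ _ λ S T →
      𝟙-*-mono (𝓕∌? y S) (𝓕∌? x T) (𝓖∖𝓕∋? y (T ─ S)) (𝓖∖𝓕∋? x (S ─ T)) λ where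
        (S∈𝓕 , y∉S) (T∈𝓕 , x∉T) →
          ─-∈𝓖∖𝓕 T∈𝓕 S∈𝓕 (resolve (covers T∈𝓕) x∉T) y∉S ,
          ─-∈𝓖∖𝓕 S∈𝓕 T∈𝓕 (resolve (Sum.swap (covers S∈𝓕)) y∉S) x∉T
      where
      resolve : ∀ {A B : Set} → A ⊎ B → ¬ A → B
      resolve (inj₁ a) ¬a = ⊥-elim (¬a a)
      resolve (inj₂ b) _  = b

∣p∣≤0⇒x∉p : ∀ {n} (p : Subset n) → ∣ p ∣ ≤ 0 → ∀ {x} → x ∉ p
∣p∣≤0⇒x∉p (outside ∷ p) ∣p∣≤0 (there x∈p) = ∣p∣≤0⇒x∉p p ∣p∣≤0 x∈p

∣p∣≤1⇒⊆-singleton : ∀ {n} (p : Subset (suc n)) → ∣ p ∣ ≤ 1 → ∃ λ x → ∀ {v} → v ∈ˢ p → v ≡ x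
∣p∣≤1⇒⊆-singleton (inside ∷ p) (s≤s ∣p∣≤0) = zero , λ where
  here          → refl
  (there v∈p)   → ⊥-elim (∣p∣≤0⇒x∉p p ∣p∣≤0 v∈p)
∣p∣≤1⇒⊆-singleton {zero}  (outside ∷ []) _ = zero , λ where (there ())
∣p∣≤1⇒⊆-singleton {suc n} (outside ∷ p) ∣p∣≤1 with x , p⊆x ← ∣p∣≤1⇒⊆-singleton p ∣p∣≤1 =
  suc x , λ where (there v∈p) → cong suc (p⊆x v∈p)

∣p∣≤2⇒⊆-pair : ∀ {n} (p : Subset (suc n)) → ∣ p ∣ ≤ 2 →
  ∃₂ λ x y → ∀ {v} → v ∈ˢ p → v ≡ x ⊎ v ≡ y
∣p∣≤2⇒⊆-pair {zero} (_ ∷ []) _ = zero , zero , λ where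
  here       → inj₁ refl
  (there ())
∣p∣≤2⇒⊆-pair {suc n} (inside ∷ p) (s≤s ∣p∣≤1) with x , p⊆x ← ∣p∣≤1⇒⊆-singleton p ∣p∣≤1 =
  zero , suc x , λ where
    here        → inj₁ refl
    (there v∈p) → inj₂ (cong suc (p⊆x v∈p))
∣p∣≤2⇒⊆-pair {suc n} (outside ∷ p) ∣p∣≤2 with x , y , p⊆xy ← ∣p∣≤2⇒⊆-pair p ∣p∣≤2 =
  suc x , suc y , λ where (there v∈p) → Sum.map (cong suc) (cong suc) (p⊆xy v∈p)

Covers⇒pair-covers : ∀ {n} {T : Subset n} {x y} {𝓕 : Family n} → (∀ {v} → v ∈ˢ T → v ≡ x ⊎ v ≡ y) →
  Covers T 𝓕 → ∀ {F} → F ∈F 𝓕 → x ∈ˢ F ⊎ y ∈ˢ F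
Covers⇒pair-covers {T = T} T⊆xy covers {F} F∈𝓕
  with v , v∈T∩F ← covers F∈𝓕 with v∈T , v∈F ← x∈p∩q⁻ T F v∈T∩F with T⊆xy v∈T
... | inj₁ refl = inj₁ v∈F
... | inj₂ refl = inj₂ v∈F

m∈ms⇒m≤foldr-⊔ : ∀ {m} {ms : List ℕ} → m List.∈ ms → m ≤ foldr _⊔_ 0 ms
m∈ms⇒m≤foldr-⊔ (Any.here refl) = m≤m⊔n _ _
m∈ms⇒m≤foldr-⊔ (Any.there m∈ms) = m≤n⇒m≤o⊔n _ (m∈ms⇒m≤foldr-⊔ m∈ms)

degree≤Δ : ∀ {n} (𝓖 : Family n) (x : Fin n) → degree 𝓖 x ≤ Δ 𝓖
degree≤Δ 𝓖 x = m∈ms⇒m≤foldr-⊔ (∈-map⁺ (degree 𝓖) (∈-allFin x))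

theorem7 : (n : ℕ) → 1 ≤ n → (𝓕 𝓖 : Family n) →
    𝓕 ⊆F 𝓖 → DownSet 𝓖 → Intersecting 𝓕 → τ≤ 𝓕 2 →
    ∣ 𝓕 ∣F ≤ Δ 𝓖
theorem7 zero    () _ _
theorem7 (suc n) _  𝓕 𝓖 𝓕⊆𝓖 down intersecting (T , ∣T∣≤2 , T-covers)
  with x , y , T⊆xy ← ∣p∣≤2⇒⊆-pair T ∣T∣≤2
  with m*n≤o*p⇒m≤o⊎n≤p (count∌*count∌≤count𝓖∖𝓕∋*count𝓖∖𝓕∋ 𝓕 𝓖 𝓕⊆𝓖 down intersecting x y
                           (Covers⇒pair-covers {𝓕 = 𝓕} T⊆xy T-covers))
... | inj₁ ∌y≤𝓖∖𝓕∋y = ≤-trans (∣𝓕∣≤degree 𝓕 𝓖 𝓕⊆𝓖 y ∌y≤𝓖∖𝓕∋y) (degree≤Δ 𝓖 y)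
... | inj₂ ∌x≤𝓖∖𝓕∋x = ≤-trans (∣𝓕∣≤degree 𝓕 𝓖 𝓕⊆𝓖 x ∌x≤𝓖∖𝓕∋x) (degree≤Δ 𝓖 x)
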